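{- Let $G=(V,E)$ be a finite simple graph on $n=|V|$ vertices and write $T\chi^L_G(q)=\sum_{\alpha}c^L_\alpha(q)M_\alpha$, summing over compositions $\alpha$ of $n$. Then each $c^L_\alpha(q)$ is a polynomial in $q$ of degree at most $|E|$ which is symmetric in the sense that $[q^k]c^L_\alpha(q)=[q^{|E|-k}]c^L_\alpha(q)$ for all $k$.
   Context: A labeling of $G$ is a bijection $L:V\to\{1,\dots,n\}$; a proper coloring is $\kappa:V\to\mathbb{Z}_{>0}$ with adjacent vertices colored differently; $\mathrm{asc}^L(\kappa)$ is the number of edges $\{u,v\}$ with $L(u)<L(v)$ and $\kappa(u)<\kappa(v)$. $\chi^L_G(x;q)=\sum_\kappa q^{\mathrm{asc}^L(\kappa)}x^\kappa$ with $x^\kappa=\prod_j x_j^{\#\kappa^{ -1}(j)}$, and $T\chi^L_G(q)=\sum_L\chi^L_G(x;q)$ over all labelings. This is a quasisymmetric function, expanded in the monomial quasisymmetric basis $M_\alpha=\sum_{i_1<\dots<i_\ell}x_{i_1}^{\alpha_1}\cdots x_{i_\ell}^{\alpha_\ell}$. $[q^k]p(q)$ denotes the coefficient of $q^k$ in $p(q)$. -}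

module Defs where

open import Data.Bool using (Bool; true; false; _∧_; _∨_; not; if_then_else_)
open import Data.Nat using (ℕ; zero; suc; _+_; _<ᵇ_; _≡ᵇ_)
open import Data.Fin using (Fin; toℕ)
open import Data.Fin.Properties using (_≟_)
open import Data.List using (List; []; _∷_; length; map; concatMap; allFin; lookup)
open import Data.Bool.ListAction using (all)
import Data.Nat.ListAction
open import Data.Vec.Functional as VF using ()
open import Relation.Nullary.Decidable using (⌊_⌋)
open import Relation.Binary.PropositionalEquality using (_≡_)
open import Data.List.Relation.Unary.All using (All)
open import Data.Product using (_×_)
open import Data.Nat using (_<_)
import Data.List

record Graph : Set where
  field
    n      : ℕ
    adj    : Fin n → Fin n → Bool
    sym    : ∀ u v → adj u v ≡ adj v u
    irrefl : ∀ v → adj v v ≡ false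
open Graph public

countᵇ : {A : Set} → (A → Bool) → List A → ℕ
countᵇ p []       = 0
countᵇ p (x ∷ xs) = if p x then suc (countᵇ p xs) else countᵇ p xs

allFuns : (n m : ℕ) → List (Fin n → Fin m)
allFuns zero    m = (λ ()) ∷ []
allFuns (suc n) m = concatMap (λ i → map (λ f → i VF.∷ f) (allFuns n m)) (allFin m)

_<F_ : {k : ℕ} → Fin k → Fin k → Bool
i <F j = toℕ i <ᵇ toℕ j

_==F_ : {k : ℕ} → Fin k → Fin k → Bool
i ==F j = ⌊ i ≟ j ⌋

sumL : {A : Set} → (A → ℕ) → List A → ℕ
sumL f []       = 0
sumL f (x ∷ xs) = f x + sumL f xs

numEdges : Graph → ℕ
numEdges G = sumL (λ u → countᵇ (λ v → (u <F v) ∧ adj G u v) (allFin (n G))) (allFin (n G))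

-- a labeling L : V → {1..n} is a bijection Fin n → Fin n (injective suffices on Fin n);
-- Boolean test of injectivity
isInjective : {k m : ℕ} → (Fin k → Fin m) → Bool
isInjective {k} f = all (λ u → all (λ v → (u ==F v) ∨ not (f u ==F f v)) (allFin k)) (allFin k)

isBijection : {k : ℕ} → (Fin k → Fin k) → Bool
isBijection = isInjective

isProper : (G : Graph) {ℓ : ℕ} → (Fin (n G) → Fin ℓ) → Bool
isProper G κ = all (λ u → all (λ v → not (adj G u v) ∨ not (κ u ==F κ v)) (allFin (n G))) (allFin (n G))

-- asc^L(κ): number of edges {u,v} with L(u) < L(v) and κ(u) < κ(v).
-- Counted over ordered pairs (u,v): each edge has exactly one orientation with L(u) < L(v).
asc : (G : Graph) {ℓ : ℕ} → (Fin (n G) → Fin (n G)) → (Fin (n G) → Fin ℓ) → ℕ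
asc G L κ = sumL (λ u → countᵇ (λ v → adj G u v ∧ (L u <F L v) ∧ (κ u <F κ v)) (allFin (n G))) (allFin (n G))

IsComposition : ℕ → List ℕ → Set
IsComposition m α = All (λ a → 0 < a) α × Data.Nat.ListAction.sum α ≡ m

-- κ : V → {1..ℓ} (ℓ = length α) has monomial x^κ = x_1^{α_1} ⋯ x_ℓ^{α_ℓ}
hasType : {k : ℕ} (α : List ℕ) → (Fin k → Fin (length α)) → Bool
hasType {k} α κ = all (λ j → countᵇ (λ v → κ v ==F j) (allFin k) ≡ᵇ lookup α j) (allFin (length α))

-- [q^j] c^L_α(q): coefficient of q^j in the coefficient of M_α in Tχ^L_G(q),
-- i.e. (since M_α contains x_1^{α_1}⋯x_ℓ^{α_ℓ} with coefficient 1 and no other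
-- M_β does) the number of pairs (L, κ) with L a labeling, κ a proper colouring with
-- x^κ = x_1^{α_1}⋯x_ℓ^{α_ℓ}, and asc^L(κ) = j.
coeff : (G : Graph) (α : List ℕ) (j : ℕ) → ℕ
coeff G α j =
  sumL (λ L → if isBijection L
                then countᵇ (λ κ → isProper G κ ∧ hasType α κ ∧ (asc G L κ ≡ᵇ j))
                            (allFuns (n G) (length α))
                else 0)
       (allFuns (n G) (n G))

{-# OPTIONS --safe #-}
module Submission where

-- Reversing labelings, L ↦ opposite ∘ L, permutes them, and for a proper colouring κ
-- each edge is an ascent for exactly one of L and its reverse, so
-- asc^L(κ) + asc^(rev L)(κ) = |E|. Reversal therefore matches the coefficient of q^k
-- with that of q^(|E|-k), and asc ≤ |E| bounds the degree. Counting edges by the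
-- orientation along which κ increases gives |E| because, for any g separating the
-- ends of every edge, twice the number of g-increasing oriented edges is the number
-- of ordered adjacent pairs, whatever g is.

open import Defs renaming (sym to adj-sym; irrefl to adj-irrefl)
open import Data.Nat using (ℕ; _<_; _≤_; _∸_)
open import Data.List using (List)
open import Data.Product using (_×_)
open import Relation.Binary.PropositionalEquality using (_≡_)

open import Algebra.Properties.CommutativeMonoid.Sum as Summation using ()
open import Data.Bool using (Bool; true; false; _∧_; _∨_; not; if_then_else_; T)
open import Data.Bool.ListAction using (all; and)
open import Data.Bool.Properties using (∧-comm; ∧-zeroʳ; T-∨; T-not-≡; if-eta)
open import Data.Empty using (⊥-elim)
open import Data.Fin using (Fin; zero; suc; toℕ; opposite)
open import Data.Fin.Permutation as Perm using (Permutation′; _⟨$⟩ʳ_)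
open import Data.Fin.Properties
  using (toℕ-injective; toℕ<n; opposite-prop; opposite-involutive) renaming (_≟_ to _≟F_)
open import Data.List using ([]; _∷_; _++_; map; concatMap; allFin; tabulate; length)
open import Data.List.Membership.Propositional.Properties using (∈-allFin)
open import Data.List.Properties using (map-cong)
open import Data.List.Relation.Unary.All as All using ()
open import Data.List.Relation.Unary.All.Properties using (all⁺)
open import Data.Nat using (zero; suc; _+_; _*_; _<ᵇ_; _≡ᵇ_; _<?_; _≟_; s<s)
open import Data.Nat.Properties
  using (+-assoc; +-suc; +-identityʳ; +-0-commutativeMonoid; +-commutativeSemigroup;
         *-cancelˡ-≡; ∸-monoʳ-<; m≤m+n; m+n∸m≡n; m+n∸n≡m; m∸[m∸n]≡n; <⇒≱)
open import Data.Product using (_,_)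
open import Data.Sum using (inj₁; inj₂)
import Data.Vec.Functional as VF
open import Function using (_∘_; id; flip; mk⇔; Equivalence; Injection)
open import Function.Definitions using (Injective)
open import Function.Properties.Inverse using (↔⇒↣)
open import Relation.Binary.PropositionalEquality
  using (refl; sym; trans; cong; cong₂; subst; subst₂; _≢_; _≗_; module ≡-Reasoning)
open import Relation.Nullary using (contradiction)
open import Relation.Nullary.Decidable
  using (does; isYes; isYes≗does; does-⇔; dec-false; toWitness; toWitnessFalse)

private
  module Σℕ = Summation +-0-commutativeMonoid
  open import Algebra.Properties.CommutativeSemigroup +-commutativeSemigroup
    using () renaming (interchange to +-interchange)

sumL-cong : ∀ {A : Set} {f g : A → ℕ} (xs : List A) → f ≗ g → sumL f xs ≡ sumL g xs
sumL-cong []       f≗g = refl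
sumL-cong (x ∷ xs) f≗g = cong₂ _+_ (f≗g x) (sumL-cong xs f≗g)

sumL-zero : ∀ {A : Set} (xs : List A) → sumL (λ _ → 0) xs ≡ 0
sumL-zero []       = refl
sumL-zero (_ ∷ xs) = sumL-zero xs

sumL-+ : ∀ {A : Set} (f g : A → ℕ) (xs : List A) →
  sumL (λ x → f x + g x) xs ≡ sumL f xs + sumL g xs
sumL-+ f g []       = refl
sumL-+ f g (x ∷ xs) =
  trans (cong (f x + g x +_) (sumL-+ f g xs)) (+-interchange (f x) (g x) (sumL f xs) (sumL g xs))

sumL-swap : ∀ {A B : Set} (f : A → B → ℕ) (xs : List A) (ys : List B) →
  sumL (λ x → sumL (f x) ys) xs ≡ sumL (λ y → sumL (flip f y) xs) ys
sumL-swap f []       ys = sym (sumL-zero ys)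
sumL-swap f (x ∷ xs) ys =
  trans (cong (sumL (f x) ys +_) (sumL-swap f xs ys)) (sym (sumL-+ (f x) _ ys))

sumL-++ : ∀ {A : Set} (f : A → ℕ) (xs ys : List A) → sumL f (xs ++ ys) ≡ sumL f xs + sumL f ys
sumL-++ f []       ys = refl
sumL-++ f (x ∷ xs) ys = trans (cong (f x +_) (sumL-++ f xs ys)) (sym (+-assoc (f x) _ _))

sumL-map : ∀ {A B : Set} (f : B → ℕ) (g : A → B) (xs : List A) →
  sumL f (map g xs) ≡ sumL (f ∘ g) xs
sumL-map f g []       = refl
sumL-map f g (x ∷ xs) = cong (f (g x) +_) (sumL-map f g xs)

sumL-concatMap : ∀ {A B : Set} (f : B → ℕ) (h : A → List B) (xs : List A) →
  sumL f (concatMap h xs) ≡ sumL (sumL f ∘ h) xs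
sumL-concatMap f h []       = refl
sumL-concatMap f h (x ∷ xs) =
  trans (sumL-++ f (h x) _) (cong (sumL f (h x) +_) (sumL-concatMap f h xs))

sumL-tabulate : ∀ {A : Set} {m} (f : A → ℕ) (g : Fin m → A) →
  sumL f (tabulate g) ≡ Σℕ.sum (f ∘ g)
sumL-tabulate {m = zero}  f g = refl
sumL-tabulate {m = suc m} f g = cong (f (g zero) +_) (sumL-tabulate f (g ∘ suc))

sumL-allFin-permute : ∀ {m} (π : Permutation′ m) (f : Fin m → ℕ) →
  sumL f (allFin m) ≡ sumL (f ∘ (π ⟨$⟩ʳ_)) (allFin m)
sumL-allFin-permute π f = begin
  sumL f (allFin _)                ≡⟨ sumL-tabulate f id ⟩
  Σℕ.sum f                         ≡⟨ Σℕ.sum-permute f π ⟩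
  Σℕ.sum (f ∘ (π ⟨$⟩ʳ_))           ≡⟨ sumL-tabulate (f ∘ (π ⟨$⟩ʳ_)) id ⟨
  sumL (f ∘ (π ⟨$⟩ʳ_)) (allFin _)  ∎
  where open ≡-Reasoning

sumL-allFuns-suc : ∀ {k m} (F : (Fin (suc k) → Fin m) → ℕ) →
  sumL F (allFuns (suc k) m) ≡ sumL (λ i → sumL (λ f → F (i VF.∷ f)) (allFuns k m)) (allFin m)
sumL-allFuns-suc {k} {m} F = trans (sumL-concatMap F _ (allFin m))
  (sumL-cong (allFin m) (λ i → sumL-map F (i VF.∷_) (allFuns k m)))

sumL-allFuns-permute : ∀ {k m} (π : Permutation′ m) (F : (Fin k → Fin m) → ℕ) →
  (∀ {f g} → f ≗ g → F f ≡ F g) →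
  sumL F (allFuns k m) ≡ sumL (λ f → F ((π ⟨$⟩ʳ_) ∘ f)) (allFuns k m)
sumL-allFuns-permute {zero}      π F F-cong = cong (_+ 0) (F-cong (λ ()))
sumL-allFuns-permute {suc k} {m} π F F-cong = begin
  sumL F (allFuns (suc k) m)
    ≡⟨ sumL-allFuns-suc F ⟩
  sumL (λ i → sumL (λ f → F (i VF.∷ f)) fs) (allFin m)
    ≡⟨ sumL-allFin-permute π _ ⟩
  sumL (λ i → sumL (λ f → F (σ i VF.∷ f)) fs) (allFin m)
    ≡⟨ sumL-cong (allFin m) (λ i → sumL-allFuns-permute π _ (F-cong ∘ ∷-cong)) ⟩
  sumL (λ i → sumL (λ f → F (σ i VF.∷ σ ∘ f)) fs) (allFin m)
    ≡⟨ sumL-cong (allFin m) (λ i → sumL-cong fs (λ f → F-cong (σ-∷ i f))) ⟩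
  sumL (λ i → sumL (λ f → F (σ ∘ (i VF.∷ f))) fs) (allFin m)
    ≡⟨ sumL-allFuns-suc (λ f → F (σ ∘ f)) ⟨
  sumL (λ f → F (σ ∘ f)) (allFuns (suc k) m) ∎
  where
  open ≡-Reasoning
  fs : List (Fin k → Fin m)
  fs = allFuns k m
  σ : Fin m → Fin m
  σ = π ⟨$⟩ʳ_
  ∷-cong : ∀ {i} {f g : Fin k → Fin m} → f ≗ g → (i VF.∷ f) ≗ (i VF.∷ g)
  ∷-cong f≗g zero    = refl
  ∷-cong f≗g (suc x) = f≗g x
  σ-∷ : ∀ i (f : Fin k → Fin m) → (σ i VF.∷ σ ∘ f) ≗ σ ∘ (i VF.∷ f)
  σ-∷ i f zero    = refl
  σ-∷ i f (suc x) = refl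

countᵇ-as-sumL : ∀ {A : Set} (p : A → Bool) (xs : List A) →
  countᵇ p xs ≡ sumL (λ x → if p x then 1 else 0) xs
countᵇ-as-sumL p []       = refl
countᵇ-as-sumL p (x ∷ xs) with p x
... | true  = cong suc (countᵇ-as-sumL p xs)
... | false = countᵇ-as-sumL p xs

countᵇ-cong : ∀ {A : Set} {p q : A → Bool} (xs : List A) → p ≗ q → countᵇ p xs ≡ countᵇ q xs
countᵇ-cong {p = p} {q} xs p≗q = begin
  countᵇ p xs                           ≡⟨ countᵇ-as-sumL p xs ⟩
  sumL (λ x → if p x then 1 else 0) xs  ≡⟨ sumL-cong xs (cong (λ b → if b then 1 else 0) ∘ p≗q) ⟩
  sumL (λ x → if q x then 1 else 0) xs  ≡⟨ countᵇ-as-sumL q xs ⟨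
  countᵇ q xs                           ∎
  where open ≡-Reasoning

countᵇ-none : ∀ {A : Set} (p : A → Bool) (xs : List A) → (∀ x → p x ≡ false) → countᵇ p xs ≡ 0
countᵇ-none p xs none = trans (countᵇ-cong xs none) (trans (countᵇ-as-sumL _ xs) (sumL-zero xs))

countᵇ-partition : ∀ {A : Set} (p q : A → Bool) (xs : List A) →
  countᵇ (λ x → p x ∧ q x) xs + countᵇ (λ x → p x ∧ not (q x)) xs ≡ countᵇ p xs
countᵇ-partition p q []       = refl
countᵇ-partition p q (x ∷ xs) with p x | q x
... | false | _     = countᵇ-partition p q xs
... | true  | true  = cong suc (countᵇ-partition p q xs)
... | true  | false = trans (+-suc _ _) (cong suc (countᵇ-partition p q xs))

∧-congˡ-T : ∀ a {x y} → (T a → x ≡ y) → a ∧ x ≡ a ∧ y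
∧-congˡ-T true  x≡y = x≡y _
∧-congˡ-T false x≡y = refl

if-cong-T : ∀ {A : Set} b {x y z : A} → (T b → x ≡ y) →
  (if b then x else z) ≡ (if b then y else z)
if-cong-T true  x≡y = x≡y _
if-cong-T false x≡y = refl

<ᵇ-flip : ∀ {x y} → x ≢ y → (y <ᵇ x) ≡ not (x <ᵇ y)
<ᵇ-flip {zero}  {zero}  x≢y = contradiction refl x≢y
<ᵇ-flip {zero}  {suc y} x≢y = refl
<ᵇ-flip {suc x} {zero}  x≢y = refl
<ᵇ-flip {suc x} {suc y} x≢y = <ᵇ-flip (x≢y ∘ cong suc)

-- For ℕ, does (m ≟ n) and does (m <? n) compute to m ≡ᵇ n and m <ᵇ n.
≡ᵇ-complement : ∀ a b {e k} → a + b ≡ e → k ≤ e → (b ≡ᵇ k) ≡ (a ≡ᵇ e ∸ k)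
≡ᵇ-complement a b {e} {k} a+b≡e k≤e = does-⇔ (mk⇔ to from) (b ≟ k) (a ≟ e ∸ k)
  where
  to : b ≡ k → a ≡ e ∸ k
  to b≡k = trans (sym (m+n∸n≡m a b)) (cong₂ _∸_ a+b≡e b≡k)
  from : a ≡ e ∸ k → b ≡ k
  from a≡e∸k = trans (sym (m+n∸m≡n a b)) (trans (cong₂ _∸_ a+b≡e a≡e∸k) (m∸[m∸n]≡n k≤e))

opposite-reverses-< : ∀ {m} {i j : Fin m} → toℕ i < toℕ j → toℕ (opposite j) < toℕ (opposite i)
opposite-reverses-< {m} {i} {j} i<j =
  subst₂ _<_ (sym (opposite-prop j)) (sym (opposite-prop i)) (∸-monoʳ-< (s<s i<j) (toℕ<n j))

opposite-<F : ∀ {m} (i j : Fin m) → (opposite i <F opposite j) ≡ (j <F i)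
opposite-<F i j = does-⇔ (mk⇔ from-opposite opposite-reverses-<) (_ <? _) (_ <? _)
  where
  from-opposite : toℕ (opposite i) < toℕ (opposite j) → toℕ j < toℕ i
  from-opposite lt = subst₂ _<_ (cong toℕ (opposite-involutive j))
                                (cong toℕ (opposite-involutive i))
                                (opposite-reverses-< lt)

module PairCount {A : Set} (xs : List A) where

  pairCount : (A → A → Bool) → ℕ
  pairCount p = sumL (λ u → countᵇ (p u) xs) xs

  pairCount-cong : ∀ {p q : A → A → Bool} → (∀ u v → p u v ≡ q u v) → pairCount p ≡ pairCount q
  pairCount-cong p≡q = sumL-cong xs (λ u → countᵇ-cong xs (p≡q u))

  pairCount-transpose : ∀ (p : A → A → Bool) → pairCount p ≡ pairCount (flip p)
  pairCount-transpose p = begin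
    pairCount p
      ≡⟨ sumL-cong xs (λ u → countᵇ-as-sumL (p u) xs) ⟩
    sumL (λ u → sumL (λ v → if p u v then 1 else 0) xs) xs
      ≡⟨ sumL-swap _ xs xs ⟩
    sumL (λ v → sumL (λ u → if p u v then 1 else 0) xs) xs
      ≡⟨ sumL-cong xs (λ v → countᵇ-as-sumL (flip p v) xs) ⟨
    pairCount (flip p) ∎
    where open ≡-Reasoning

  pairCount-partition : ∀ (p q : A → A → Bool) →
    pairCount (λ u v → p u v ∧ q u v) + pairCount (λ u v → p u v ∧ not (q u v)) ≡ pairCount p
  pairCount-partition p q =
    trans (sym (sumL-+ _ _ xs)) (sumL-cong xs (λ u → countᵇ-partition (p u) (q u) xs))

  module _ {b : A → A → Bool} (b-sym : ∀ u v → b u v ≡ b v u) where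

    pairCount-orientations : (g : A → ℕ) → (∀ u v → T (b u v) → g u ≢ g v) →
      2 * pairCount (λ u v → b u v ∧ (g u <ᵇ g v)) ≡ pairCount b
    pairCount-orientations g separates = begin
      2 * P                                             ≡⟨ cong (P +_) (+-identityʳ P) ⟩
      P + P                                             ≡⟨ cong (P +_) (pairCount-transpose _) ⟩
      P + pairCount (λ u v → b v u ∧ (g v <ᵇ g u))      ≡⟨ cong (P +_) (pairCount-cong reversed) ⟩
      P + pairCount (λ u v → b u v ∧ not (g u <ᵇ g v))  ≡⟨ pairCount-partition b _ ⟩
      pairCount b                                       ∎
      where
      open ≡-Reasoning
      P : ℕ
      P = pairCount (λ u v → b u v ∧ (g u <ᵇ g v))
      reversed : ∀ u v → b v u ∧ (g v <ᵇ g u) ≡ b u v ∧ not (g u <ᵇ g v)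
      reversed u v = trans (cong (_∧ (g v <ᵇ g u)) (b-sym v u))
                           (∧-congˡ-T (b u v) (<ᵇ-flip ∘ separates u v))

    pairCount-orientation-invariant : (g h : A → ℕ) →
      (∀ u v → T (b u v) → g u ≢ g v) → (∀ u v → T (b u v) → h u ≢ h v) →
      pairCount (λ u v → b u v ∧ (g u <ᵇ g v)) ≡ pairCount (λ u v → b u v ∧ (h u <ᵇ h v))
    pairCount-orientation-invariant g h g-separates h-separates = *-cancelˡ-≡ _ _ 2
      (trans (pairCount-orientations g g-separates) (sym (pairCount-orientations h h-separates)))

T-all²-allFin : ∀ {k} (p : Fin k → Fin k → Bool) →
  T (all (λ u → all (p u) (allFin k)) (allFin k)) → ∀ u v → T (p u v)
T-all²-allFin p all-p u v =
  All.lookup (all⁺ (p u) _ (All.lookup (all⁺ _ _ all-p) (∈-allFin u))) (∈-allFin v)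

isInjective⇒injective : ∀ {k m} {f : Fin k → Fin m} → T (isInjective f) → Injective _≡_ _≡_ f
isInjective⇒injective {f = f} inj {u} {v} fu≡fv
  with Equivalence.to (T-∨ {u ==F v})
         (T-all²-allFin (λ u v → (u ==F v) ∨ not (f u ==F f v)) inj u v)
... | inj₁ u≡v   = toWitness u≡v
... | inj₂ fu≢fv = contradiction fu≡fv (toWitnessFalse fu≢fv)

==F-injective : ∀ {k m} {σ : Fin k → Fin m} → Injective _≡_ _≡_ σ →
  ∀ {i j} → (σ i ==F σ j) ≡ (i ==F j)
==F-injective {σ = σ} σ-injective {i} {j} = begin
  isYes (σ i ≟F σ j)  ≡⟨ isYes≗does (σ i ≟F σ j) ⟩
  does (σ i ≟F σ j)   ≡⟨ does-⇔ (mk⇔ σ-injective (cong σ)) (σ i ≟F σ j) (i ≟F j) ⟩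
  does (i ≟F j)       ≡⟨ isYes≗does (i ≟F j) ⟨
  isYes (i ≟F j)      ∎
  where open ≡-Reasoning

isInjective-cong : ∀ {k m} {f g : Fin k → Fin m} →
  (∀ u v → (f u ==F f v) ≡ (g u ==F g v)) → isInjective f ≡ isInjective g
isInjective-cong {k} same = cong and (map-cong (λ u → cong and (map-cong (λ v →
  cong (λ t → (u ==F v) ∨ not t) (same u v)) (allFin k))) (allFin k))

isInjective-permute : ∀ {k m} (π : Permutation′ m) (f : Fin k → Fin m) →
  isInjective ((π ⟨$⟩ʳ_) ∘ f) ≡ isInjective f
isInjective-permute π f = isInjective-cong (λ u v →
  ==F-injective {σ = π ⟨$⟩ʳ_} (Injection.injective (↔⇒↣ π)) {f u} {f v})

module _ (G : Graph) where

  open PairCount (allFin (n G))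

  Vertex : Set
  Vertex = Fin (n G)

  Proper : ∀ {ℓ} → (Vertex → Fin ℓ) → Set
  Proper κ = ∀ {u v} → T (adj G u v) → κ u ≢ κ v

  adj-irreflexive : ∀ {u v} → T (adj G u v) → u ≢ v
  adj-irreflexive {u} uv refl = subst T (adj-irrefl G u) uv

  isProper⇒Proper : ∀ {ℓ} {κ : Vertex → Fin ℓ} → T (isProper G κ) → Proper κ
  isProper⇒Proper {κ = κ} proper {u} {v} uv
    with Equivalence.to (T-∨ {not (adj G u v)})
           (T-all²-allFin (λ u v → not (adj G u v) ∨ not (κ u ==F κ v)) proper u v)
  ... | inj₁ ¬uv   = ⊥-elim (subst T (Equivalence.to T-not-≡ ¬uv) uv)
  ... | inj₂ κu≢κv = toWitnessFalse κu≢κv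

  asc-cong : ∀ {ℓ} {L M : Vertex → Vertex} (κ : Vertex → Fin ℓ) → L ≗ M →
    asc G L κ ≡ asc G M κ
  asc-cong κ L≗M = pairCount-cong (λ u v →
    cong (λ c → adj G u v ∧ (c ∧ (κ u <F κ v))) (cong₂ _<F_ (L≗M u) (L≗M v)))

  asc-+-asc-opposite : ∀ {ℓ} {L : Vertex → Vertex} {κ : Vertex → Fin ℓ} →
    Injective _≡_ _≡_ L → Proper κ → asc G L κ + asc G (opposite ∘ L) κ ≡ numEdges G
  asc-+-asc-opposite {L = L} {κ} L-injective proper = begin
    asc G L κ + asc G (opposite ∘ L) κ
      ≡⟨ cong₂ _+_ (pairCount-cong (λ u v → ∧-rotate (adj G u v) (L u <F L v) (κ u <F κ v)))
                   (pairCount-cong reversed) ⟩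
    pairCount (λ u v → κ-asc u v ∧ (L u <F L v)) + pairCount (λ u v → κ-asc u v ∧ not (L u <F L v))
      ≡⟨ pairCount-partition κ-asc _ ⟩
    pairCount κ-asc
      ≡⟨ pairCount-orientation-invariant (adj-sym G) (toℕ ∘ κ) toℕ
           (λ u v uv → proper uv ∘ toℕ-injective) (λ u v uv → adj-irreflexive uv ∘ toℕ-injective) ⟩
    pairCount (λ u v → adj G u v ∧ (u <F v))
      ≡⟨ pairCount-cong (λ u v → ∧-comm (adj G u v) _) ⟩
    numEdges G ∎
    where
    open ≡-Reasoning
    κ-asc : Vertex → Vertex → Bool
    κ-asc u v = adj G u v ∧ (κ u <F κ v)
    ∧-rotate : ∀ a b c → a ∧ (b ∧ c) ≡ (a ∧ c) ∧ b
    ∧-rotate true  b c = ∧-comm b c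
    ∧-rotate false b c = refl
    reversed : ∀ u v → adj G u v ∧ ((opposite (L u) <F opposite (L v)) ∧ (κ u <F κ v))
                     ≡ κ-asc u v ∧ not (L u <F L v)
    reversed u v = begin
      adj G u v ∧ ((opposite (L u) <F opposite (L v)) ∧ (κ u <F κ v))
        ≡⟨ cong (λ c → adj G u v ∧ (c ∧ (κ u <F κ v))) (opposite-<F (L u) (L v)) ⟩
      adj G u v ∧ ((L v <F L u) ∧ (κ u <F κ v))
        ≡⟨ ∧-congˡ-T (adj G u v) (λ uv →
             cong (_∧ (κ u <F κ v)) (<ᵇ-flip (adj-irreflexive uv ∘ L-injective ∘ toℕ-injective))) ⟩
      adj G u v ∧ (not (L u <F L v) ∧ (κ u <F κ v))
        ≡⟨ ∧-rotate (adj G u v) (not (L u <F L v)) (κ u <F κ v) ⟩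
      κ-asc u v ∧ not (L u <F L v) ∎

  asc≤numEdges : ∀ {ℓ} {L : Vertex → Vertex} {κ : Vertex → Fin ℓ} →
    Injective _≡_ _≡_ L → Proper κ → asc G L κ ≤ numEdges G
  asc≤numEdges {L = L} {κ} L-injective proper =
    subst (asc G L κ ≤_) (asc-+-asc-opposite L-injective proper) (m≤m+n _ _)

  ascCount : (α : List ℕ) → (Vertex → Vertex) → ℕ → ℕ
  ascCount α L j =
    countᵇ (λ κ → isProper G κ ∧ hasType α κ ∧ (asc G L κ ≡ᵇ j)) (allFuns (n G) (length α))

  -- coeff G α j is, by definition, the sum of labelCoeff α j L over all L : Vertex → Vertex.
  labelCoeff : List ℕ → ℕ → (Vertex → Vertex) → ℕ
  labelCoeff α j L = if isBijection L then ascCount α L j else 0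

  ascCount-opposite : ∀ α {k} {L : Vertex → Vertex} → Injective _≡_ _≡_ L → k ≤ numEdges G →
    ascCount α (opposite ∘ L) k ≡ ascCount α L (numEdges G ∸ k)
  ascCount-opposite α {k} {L} L-injective k≤E = countᵇ-cong (allFuns (n G) (length α)) (λ κ →
    ∧-congˡ-T (isProper G κ) (λ proper → cong (hasType α κ ∧_)
      (≡ᵇ-complement (asc G L κ) _ (asc-+-asc-opposite L-injective (isProper⇒Proper proper)) k≤E)))

  ascCount-vanishes : ∀ α {k} {L : Vertex → Vertex} → Injective _≡_ _≡_ L → numEdges G < k →
    ascCount α L k ≡ 0
  ascCount-vanishes α {k} {L} L-injective E<k = countᵇ-none _ (allFuns (n G) (length α)) (λ κ →
    trans (∧-congˡ-T (isProper G κ) (λ proper →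
             trans (cong (hasType α κ ∧_) (dec-false (asc G L κ ≟ k) (asc≢k proper)))
                   (∧-zeroʳ (hasType α κ))))
          (∧-zeroʳ (isProper G κ)))
    where
    asc≢k : ∀ {κ : Vertex → Fin (length α)} → T (isProper G κ) → asc G L κ ≢ k
    asc≢k {κ} proper asc≡k = <⇒≱ E<k (subst (_≤ numEdges G) asc≡k
      (asc≤numEdges {L = L} {κ} L-injective (isProper⇒Proper proper)))

  labelCoeff-cong : ∀ α j {L M : Vertex → Vertex} → L ≗ M → labelCoeff α j L ≡ labelCoeff α j M
  labelCoeff-cong α j L≗M = cong₂ (λ b c → if b then c else 0)
    (isInjective-cong (λ u v → cong₂ _==F_ (L≗M u) (L≗M v)))
    (countᵇ-cong (allFuns (n G) (length α))
      (λ κ → cong (λ a → isProper G κ ∧ hasType α κ ∧ (a ≡ᵇ j)) (asc-cong κ L≗M)))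

  labelCoeff-opposite : ∀ α {k} (L : Vertex → Vertex) → k ≤ numEdges G →
    labelCoeff α k (opposite ∘ L) ≡ labelCoeff α (numEdges G ∸ k) L
  labelCoeff-opposite α {k} L k≤E = trans
    (cong (λ b → if b then ascCount α (opposite ∘ L) k else 0) (isInjective-permute Perm.reverse L))
    (if-cong-T (isInjective L) (λ injective →
      ascCount-opposite α (isInjective⇒injective injective) k≤E))

  labelCoeff-vanishes : ∀ α {k} (L : Vertex → Vertex) → numEdges G < k → labelCoeff α k L ≡ 0
  labelCoeff-vanishes α L E<k = trans
    (if-cong-T (isInjective L) (λ injective →
      ascCount-vanishes α (isInjective⇒injective injective) E<k))
    (if-eta (isInjective L))

proposition3p4 : (G : Graph) (α : List ℕ) → IsComposition (n G) α →
    ((k : ℕ) → numEdges G < k → coeff G α k ≡ 0) ×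
    ((k : ℕ) → k ≤ numEdges G → coeff G α k ≡ coeff G α (numEdges G ∸ k))
proposition3p4 G α _ = vanishing , symmetric
  where
  labelings : List (Fin (n G) → Fin (n G))
  labelings = allFuns (n G) (n G)
  vanishing : (k : ℕ) → numEdges G < k → coeff G α k ≡ 0
  vanishing k E<k =
    trans (sumL-cong labelings (λ L → labelCoeff-vanishes G α L E<k)) (sumL-zero labelings)
  symmetric : (k : ℕ) → k ≤ numEdges G → coeff G α k ≡ coeff G α (numEdges G ∸ k)
  symmetric k k≤E = begin
    coeff G α k
      ≡⟨ sumL-allFuns-permute Perm.reverse (labelCoeff G α k) (labelCoeff-cong G α k) ⟩
    sumL (λ L → labelCoeff G α k (opposite ∘ L)) labelings
      ≡⟨ sumL-cong labelings (λ L → labelCoeff-opposite G α L k≤E) ⟩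
    coeff G α (numEdges G ∸ k) ∎
    where open ≡-Reasoning
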